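{- Let $(G,\sigma)$ be a connected bipartite graph with $\sigma$ the vertex 2-coloring given by its bipartition, and let $x\in V(G)$ be a vertex of maximum degree in $G$. If $G$ is $P_6$-free, then for every $x'\in V(G)$ with $\sigma(x')=\sigma(x)$ there exists a vertex $y$ with $\sigma(y)\neq\sigma(x)$ such that $xy\in E(G)$ and $x'y\in E(G)$.
   Context: $P_6$ is the path on six vertices; $P_6$-free means having no induced subgraph isomorphic to $P_6$. -}

module Defs where

open import Data.Nat using (ℕ; zero; suc; _≤_; _≡ᵇ_)
open import Data.Bool using (Bool; true; false; if_then_else_; _∨_)
open import Data.Fin using (Fin; toℕ)
open import Data.List using (List; map; allFin)
open import Data.Nat.ListAction using (sum)
open import Data.Product using (_×_; Σ)
open import Relation.Binary.PropositionalEquality using (_≡_)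
open import Relation.Binary.Construct.Closure.ReflexiveTransitive using (Star)
open import Function.Definitions using (Injective)

record Graph (n : ℕ) : Set where
  field
    adj   : Fin n → Fin n → Bool
    sym   : ∀ u v → adj u v ≡ adj v u
    irrefl : ∀ v → adj v v ≡ false
open Graph public

Edge : ∀ {n} → Graph n → Fin n → Fin n → Set
Edge G u v = adj G u v ≡ true

deg : ∀ {n} → Graph n → Fin n → ℕ
deg {n} G x = sum (map (λ v → if adj G x v then 1 else 0) (allFin n))

MaxDegree : ∀ {n} → Graph n → Fin n → Set
MaxDegree G x = ∀ v → deg G v ≤ deg G x

Connected : ∀ {n} → Graph n → Set
Connected G = ∀ u v → Star (Edge G) u v

ProperTwoColouring : ∀ {n} → Graph n → (Fin n → Bool) → Set
ProperTwoColouring G σ = ∀ u v → Edge G u v → σ u ≡ σ v → Data.Empty.⊥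
  where import Data.Empty

P6adj : Fin 6 → Fin 6 → Bool
P6adj i j = (suc (toℕ i) ≡ᵇ toℕ j) ∨ (suc (toℕ j) ≡ᵇ toℕ i)

InducedP6 : ∀ {n} → Graph n → Set
InducedP6 {n} G = Σ (Fin 6 → Fin n) λ f →
  Injective _≡_ _≡_ f × (∀ i j → adj G (f i) (f j) ≡ P6adj i j)

P6Free : ∀ {n} → Graph n → Set
P6Free G = InducedP6 G → Data.Empty.⊥
  where import Data.Empty

-- Call a vertex v "good" if it has a common neighbour with x.  If u is good, via a,
-- and u – p – q is a path, then q is good: otherwise p ∉ N(x), so N(u) ⊈ N(x), and
-- since deg u ≤ deg x there is w ∈ N(x) ∖ N(u); then w – x – a – u – p – q is an
-- induced P₆ (bipartiteness kills every chord between vertices of equal parity, and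
-- the four remaining chords are excluded by the choice of p, q and w).  As x is good,
-- every vertex on a walk from x is good or adjacent to a good vertex, and for x' of
-- the colour of x the second alternative is impossible.
module Submission where

open import Defs
open import Data.Nat using (ℕ; suc; _≤_; _<_; _≡ᵇ_; z≤n; s≤s)
open import Data.Nat.Properties using (≤-refl; +-mono-≤; +-mono-≤-<; <⇒≱)
open import Data.Nat.ListAction using (sum)
open import Data.Bool using (Bool; true; false; if_then_else_)
open import Data.Bool.Properties using (¬-not; ∨-comm) renaming (_≟_ to _≟ᵇ_)
open import Data.Fin using (Fin; zero; suc; toℕ; punchIn) renaming (_<_ to _<ᶠ_; _≟_ to _≟ᶠ_)
open import Data.Fin.Patterns using (0F; 1F; 2F; 3F; 4F; 5F)
open import Data.Fin.Properties using (any?; all?; <-cmp; punchInᵢ≢i)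
open import Data.Vec using (_∷_; []; lookup)
open import Data.List using (List; []; _∷_; map; allFin)
open import Data.List.Relation.Unary.Any using (here; there)
open import Data.List.Membership.Propositional using (_∈_)
open import Data.List.Membership.Propositional.Properties using (∈-allFin)
open import Data.Product using (Σ; _×_; _,_)
open import Data.Sum using (_⊎_; inj₁; inj₂)
open import Data.Empty using (⊥-elim)
open import Relation.Nullary using (¬_; Dec; yes; no; ¬?)
open import Relation.Nullary.Decidable using (toWitness; decidable-stable; _×-dec_; _⊎-dec_)
open import Relation.Binary using (tri<; tri≈; tri>)
open import Relation.Binary.PropositionalEquality using (_≡_; _≢_; refl; trans; cong) renaming (sym to ≡-sym)
open import Relation.Binary.Construct.Closure.ReflexiveTransitive using (Star; ε; _◅_)

countTrue : {A : Set} → (A → Bool) → List A → ℕ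
countTrue f xs = sum (map (λ a → if f a then 1 else 0) xs)

module _ {A : Set} {f g : A → Bool} (f⊆g : ∀ a → f a ≡ true → g a ≡ true) where

  indicator-mono : ∀ a → (if f a then 1 else 0) ≤ (if g a then 1 else 0)
  indicator-mono a with f a in fa
  ... | false = z≤n
  ... | true rewrite f⊆g a fa = ≤-refl

  countTrue-mono : ∀ xs → countTrue f xs ≤ countTrue g xs
  countTrue-mono []       = z≤n
  countTrue-mono (a ∷ xs) = +-mono-≤ (indicator-mono a) (countTrue-mono xs)

  countTrue-mono-< : ∀ {p xs} → p ∈ xs → f p ≡ false → g p ≡ true →
                     countTrue f xs < countTrue g xs
  countTrue-mono-< {xs = _ ∷ xs} (here refl) fp gp rewrite fp | gp = s≤s (countTrue-mono xs)
  countTrue-mono-< {xs = a ∷ _}  (there p∈xs) fp gp =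
    +-mono-≤-< (indicator-mono a) (countTrue-mono-< p∈xs fp gp)

P6adj-irrefl : ∀ i → P6adj i i ≡ false
P6adj-irrefl = toWitness {a? = all? λ i → P6adj i i ≟ᵇ false} _

P6adj-sym : ∀ i j → P6adj i j ≡ P6adj j i
P6adj-sym i j = ∨-comm (suc (toℕ i) ≡ᵇ toℕ j) (suc (toℕ j) ≡ᵇ toℕ i)

P6adj-rows-injective : ∀ i j → (∀ k → P6adj i k ≡ P6adj j k) → i ≡ j
P6adj-rows-injective i j sameRow with separated i j
  where
  separated : ∀ i j → i ≡ j ⊎ Σ (Fin 6) λ k → P6adj i k ≢ P6adj j k
  separated = toWitness {a? = all? λ i → all? λ j →
    (i ≟ᶠ j) ⊎-dec any? (λ k → ¬? (P6adj i k ≟ᵇ P6adj j k))} _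
... | inj₁ i≡j       = i≡j
... | inj₂ (k , i≢j) = ⊥-elim (i≢j (sameRow k))

module _ {n} (G : Graph n) where

  Edge-sym : ∀ {u v} → Edge G u v → Edge G v u
  Edge-sym {u} {v} uv = trans (Graph.sym G v u) uv

  CommonNeighbour : Fin n → Fin n → Set
  CommonNeighbour x v = Σ (Fin n) λ y → Edge G x y × Edge G v y

  commonNeighbour? : ∀ x v → Dec (CommonNeighbour x v)
  commonNeighbour? x v = any? λ y → (adj G x y ≟ᵇ true) ×-dec (adj G v y ≟ᵇ true)

  connected⇒neighbour : 2 ≤ n → Connected G → ∀ x → Σ (Fin n) (Edge G x)
  connected⇒neighbour (s≤s (s≤s _)) connected x =
    firstStep (connected x (punchIn x zero)) (punchInᵢ≢i x zero)
    where
    firstStep : ∀ {z} → Star (Edge G) x z → z ≢ x → Σ (Fin n) (Edge G x)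
    firstStep ε        x≢x = ⊥-elim (x≢x refl)
    firstStep (xy ◅ _) _   = _ , xy

  inducedP6-fromUpper : (f : Fin 6 → Fin n) →
    (∀ i j → i <ᶠ j → adj G (f i) (f j) ≡ P6adj i j) → InducedP6 G
  inducedP6-fromUpper f upper = f , injective , adjacency
    where
    adjacency : ∀ i j → adj G (f i) (f j) ≡ P6adj i j
    adjacency i j with <-cmp i j
    ... | tri< i<j _ _ = upper i j i<j
    ... | tri≈ _ refl _ = trans (irrefl G (f i)) (≡-sym (P6adj-irrefl i))
    ... | tri> _ _ j<i = trans (Graph.sym G (f i) (f j)) (trans (upper j i j<i) (P6adj-sym j i))

    injective : ∀ {i j} → f i ≡ f j → i ≡ j
    injective {i} {j} fi≡fj = P6adj-rows-injective i j λ k →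
      trans (≡-sym (adjacency i k)) (trans (cong (λ v → adj G v (f k)) fi≡fj) (adjacency j k))

  deg-< : ∀ {x u p} → (∀ w → Edge G x w → Edge G u w) → Edge G u p → ¬ Edge G x p →
          deg G x < deg G u
  deg-< {p = p} N[x]⊆N[u] up ¬xp =
    countTrue-mono-< N[x]⊆N[u] (∈-allFin p) (¬-not ¬xp) up

  maxDegree-⊈ : ∀ {x u p} → MaxDegree G x → Edge G u p → ¬ Edge G x p →
                Σ (Fin n) λ w → Edge G x w × ¬ Edge G u w
  maxDegree-⊈ {x} {u} maxDeg up ¬xp
    with any? (λ w → (adj G x w ≟ᵇ true) ×-dec ¬? (adj G u w ≟ᵇ true))
  ... | yes escape = escape
  ... | no ¬escape = ⊥-elim (<⇒≱ (deg-< N[x]⊆N[u] up ¬xp) (maxDeg u))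
    where
    N[x]⊆N[u] : ∀ w → Edge G x w → Edge G u w
    N[x]⊆N[u] w xw = decidable-stable (adj G u w ≟ᵇ true) λ ¬uw → ¬escape (w , xw , ¬uw)

module _ {n} {G : Graph n} {σ : Fin n → Bool} (proper : ProperTwoColouring G σ) where

  sameColour⇒nonadjacent : ∀ {u v} → σ u ≡ σ v → adj G u v ≡ false
  sameColour⇒nonadjacent {u} {v} σu≡σv = ¬-not λ uv → proper u v uv σu≡σv

  twoStep-sameColour : ∀ {u v w} → Edge G u v → Edge G v w → σ u ≡ σ w
  twoStep-sameColour {u} {v} {w} uv vw =
    trans (¬-not (proper u v uv)) (≡-sym (¬-not (proper w v (Edge-sym G vw))))

  bipartite-inducedP6 : ∀ {v₀ v₁ v₂ v₃ v₄ v₅} →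
    Edge G v₀ v₁ → Edge G v₁ v₂ → Edge G v₂ v₃ → Edge G v₃ v₄ → Edge G v₄ v₅ →
    ¬ Edge G v₀ v₃ → ¬ Edge G v₁ v₄ → ¬ Edge G v₂ v₅ → ¬ Edge G v₀ v₅ → InducedP6 G
  bipartite-inducedP6 {v₀} {v₁} {v₂} {v₃} {v₄} {v₅} e₀₁ e₁₂ e₂₃ e₃₄ e₄₅ ¬e₀₃ ¬e₁₄ ¬e₂₅ ¬e₀₅ =
    inducedP6-fromUpper G v upper
    where
    v : Fin 6 → Fin n
    v = lookup (v₀ ∷ v₁ ∷ v₂ ∷ v₃ ∷ v₄ ∷ v₅ ∷ [])

    σ₀≡σ₂ : σ v₀ ≡ σ v₂
    σ₀≡σ₂ = twoStep-sameColour e₀₁ e₁₂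
    σ₁≡σ₃ : σ v₁ ≡ σ v₃
    σ₁≡σ₃ = twoStep-sameColour e₁₂ e₂₃
    σ₂≡σ₄ : σ v₂ ≡ σ v₄
    σ₂≡σ₄ = twoStep-sameColour e₂₃ e₃₄
    σ₃≡σ₅ : σ v₃ ≡ σ v₅
    σ₃≡σ₅ = twoStep-sameColour e₃₄ e₄₅

    upper : ∀ i j → i <ᶠ j → adj G (v i) (v j) ≡ P6adj i j
    upper _  0F ()
    upper 0F 1F _ = e₀₁
    upper (suc _) 1F (s≤s ())
    upper 0F 2F _ = sameColour⇒nonadjacent σ₀≡σ₂
    upper 1F 2F _ = e₁₂
    upper (suc (suc _)) 2F (s≤s (s≤s ()))
    upper 0F 3F _ = ¬-not ¬e₀₃
    upper 1F 3F _ = sameColour⇒nonadjacent σ₁≡σ₃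
    upper 2F 3F _ = e₂₃
    upper (suc (suc (suc _))) 3F (s≤s (s≤s (s≤s ())))
    upper 0F 4F _ = sameColour⇒nonadjacent (trans σ₀≡σ₂ σ₂≡σ₄)
    upper 1F 4F _ = ¬-not ¬e₁₄
    upper 2F 4F _ = sameColour⇒nonadjacent σ₂≡σ₄
    upper 3F 4F _ = e₃₄
    upper (suc (suc (suc (suc _)))) 4F (s≤s (s≤s (s≤s (s≤s ()))))
    upper 0F 5F _ = ¬-not ¬e₀₅
    upper 1F 5F _ = sameColour⇒nonadjacent (trans σ₁≡σ₃ σ₃≡σ₅)
    upper 2F 5F _ = ¬-not ¬e₂₅
    upper 3F 5F _ = sameColour⇒nonadjacent σ₃≡σ₅
    upper 4F 5F _ = e₄₅
    upper (suc (suc (suc (suc (suc _))))) 5F (s≤s (s≤s (s≤s (s≤s (s≤s ())))))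

  commonNeighbour⇒sameColour : ∀ {x v} → CommonNeighbour G x v → σ v ≡ σ x
  commonNeighbour⇒sameColour (y , xy , vy) = twoStep-sameColour vy (Edge-sym G xy)

  module _ {x : Fin n} (maxDeg : MaxDegree G x) where

    ¬commonNeighbour⇒inducedP6 : ∀ {u p q} → CommonNeighbour G x u → Edge G u p →
                                 Edge G p q → ¬ CommonNeighbour G x q → InducedP6 G
    ¬commonNeighbour⇒inducedP6 {u} {p} {q} (a , xa , ua) up pq ¬common =
      inducedPath (maxDegree-⊈ G maxDeg up ¬xp)
      where
      ¬xp : ¬ Edge G x p
      ¬xp xp = ¬common (p , xp , Edge-sym G pq)

      ¬aq : ¬ Edge G a q
      ¬aq aq = ¬common (a , xa , Edge-sym G aq)

      inducedPath : Σ (Fin n) (λ w → Edge G x w × ¬ Edge G u w) → InducedP6 G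
      inducedPath (w , xw , ¬uw) =
        bipartite-inducedP6 (Edge-sym G xw) xa (Edge-sym G ua) up pq
          (λ wu → ¬uw (Edge-sym G wu)) ¬xp ¬aq (λ wq → ¬common (w , xw , Edge-sym G wq))

    module _ (p6Free : P6Free G) where

      commonNeighbour-step : ∀ {u p q} → CommonNeighbour G x u → Edge G u p → Edge G p q →
                             CommonNeighbour G x q
      commonNeighbour-step {q = q} common up pq with commonNeighbour? G x q
      ... | yes common′ = common′
      ... | no ¬common  = ⊥-elim (p6Free (¬commonNeighbour⇒inducedP6 common up pq ¬common))

      CommonOrAdjacent : Fin n → Set
      CommonOrAdjacent v =
        CommonNeighbour G x v ⊎ Σ (Fin n) λ u → CommonNeighbour G x u × Edge G u v

      commonOrAdjacent-walk : ∀ {v w} → CommonOrAdjacent v → Star (Edge G) v w →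
                              CommonOrAdjacent w
      commonOrAdjacent-walk now                      ε           = now
      commonOrAdjacent-walk (inj₁ common)            (vw ◅ walk) =
        commonOrAdjacent-walk (inj₂ (_ , common , vw)) walk
      commonOrAdjacent-walk (inj₂ (_ , common , uv)) (vw ◅ walk) =
        commonOrAdjacent-walk (inj₁ (commonNeighbour-step common uv vw)) walk

lemma6p1 : ∀ {n} → 2 ≤ n → (G : Graph n) → (σ : Fin n → Bool) →
    Connected G → ProperTwoColouring G σ → (x : Fin n) → MaxDegree G x →
    P6Free G → (x' : Fin n) → σ x' ≡ σ x →
    Σ (Fin n) λ y → σ y ≢ σ x × Edge G x y × Edge G x' y
lemma6p1 2≤n G σ connected proper x maxDeg p6Free x' σx'≡σx
  with commonOrAdjacent-walk {G = G} proper maxDeg p6Free (inj₁ xIsCommon) (connected x x')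
  where
  xIsCommon : CommonNeighbour G x x
  xIsCommon with connected⇒neighbour G 2≤n connected x
  ... | y , xy = y , xy , xy
... | inj₁ (y , xy , x'y) = y , (λ σy≡σx → proper x y xy (≡-sym σy≡σx)) , xy , x'y
... | inj₂ (u , common , ux') =
  ⊥-elim (proper u x' ux' (trans (commonNeighbour⇒sameColour {G = G} proper common) (≡-sym σx'≡σx)))
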